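{- (Soundness.) For any statement $s$, state predicate $U$ and setoid trace predicate $P$, if $\vdash\{U\}\,s\,\{P\}$ is derivable in the trace-based Hoare logic, then for all states $\sigma$ and traces $\tau$, if $\sigma\models U$ and $s,\sigma\Rightarrow\tau$, then $\tau\models P$.
   Context: While statements: $s ::= x:=e \mid \mathsf{skip}\mid s_0;s_1\mid \mathsf{if}\ e\ \mathsf{then}\ s_t\ \mathsf{else}\ s_f\mid \mathsf{while}\ e\ \mathsf{do}\ s_t$, with $x$ integer variables and $e$ arithmetic expressions; a state $\sigma$ assigns integers to variables, $[\![e]\!]\sigma$ is the value, $\sigma\models e$ means $e$ is true in $\sigma$. The metatheory is constructive. Traces are coinductive: $\langle\sigma\rangle$, and $\sigma::\tau$ for a trace $\tau$; bisimilarity $\approx$ is coinductive ($\langle\sigma\rangle\approx\langle\sigma\rangle$; $\sigma::\tau\approx\sigma::\tau'$ if $\tau\approx\tau'$); $\mathit{hd}\langle\sigma\rangle=\mathit{hd}(\sigma::\tau)=\sigma$. Evaluation $s,\sigma\Rightarrow\tau$ and extended evaluation $s,\tau\Rightarrow^*\tau'$ are defined simultaneously coinductively by: $x:=e,\sigma\Rightarrow\sigma::\langle\sigma[x\mapsto[\![e]\!]\sigma]\rangle$; $\mathsf{skip},\sigma\Rightarrow\langle\sigma\rangle$; $s_0;s_1,\sigma\Rightarrow\tau'$ if $s_0,\sigma\Rightarrow\tau$ and $s_1,\tau\Rightarrow^*\tau'$; $\mathsf{if}\ e\ \mathsf{then}\ s_t\ \mathsf{else}\ s_f,\sigma\Rightarrow\tau$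 if $\sigma\models e$ and $s_t,\sigma::\langle\sigma\rangle\Rightarrow^*\tau$, or if $\sigma\not\models e$ and $s_f,\sigma::\langle\sigma\rangle\Rightarrow^*\tau$; $\mathsf{while}\ e\ \mathsf{do}\ s_t,\sigma\Rightarrow\tau'$ if $\sigma\models e$, $s_t,\sigma::\langle\sigma\rangle\Rightarrow^*\tau$ and $\mathsf{while}\ e\ \mathsf{do}\ s_t,\tau\Rightarrow^*\tau'$; $\mathsf{while}\ e\ \mathsf{do}\ s_t,\sigma\Rightarrow\sigma::\langle\sigma\rangle$ if $\sigma\not\models e$; $s,\langle\sigma\rangle\Rightarrow^*\tau$ if $s,\sigma\Rightarrow\tau$; $s,\sigma::\tau\Rightarrow^*\sigma::\tau'$ if $s,\tau\Rightarrow^*\tau'$. State predicates are arbitrary; trace predicates are setoid predicates (invariant under $\approx$); $\wedge,\neg,\exists$ are pointwise; $\models$ is also entailment. $\langle U\rangle$ holds exactly of $\langle\sigma\rangle$ with $\sigma\models U$; $\mathrm{dup}(U)$ exactly of $\sigma::\langle\sigma\rangle$ with $\sigma\models U$; $U[x\mapsto e]$ exactly of $\sigma::\langle\sigma[x\mapsto[\![e]\!]\sigma]\rangle$ with $\sigma\models U$. $\mathrm{follows}_Q(\tau,\tau')$ is coinductive: $\mathrm{follows}_Q(\langle\sigma\rangle,\tau)$ if $\mathit{hd}\,\tau=\sigma$ and $\tau\models Q$; $\mathrm{follows}_Q(\sigma::\tau,\sigma::\tau')$ if $\mathrm{follows}_Q(\tau,\tau')$. $\tau'\models P\ast\ast Q$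 iff $\exists\tau$, $\tau\models P$ and $\mathrm{follows}_Q(\tau,\tau')$ (chains associate to the right). $P^{\dagger}$ is coinductive: $\tau\models P^{\dagger}$ if $\tau\models\langle\mathsf{true}\rangle$; $\tau'\models P^{\dagger}$ if $\exists\tau$, $\tau\models P$ and $\mathrm{follows}_{P^{\dagger}}(\tau,\tau')$. The trace-based Hoare logic derives $\{U\}\,s\,\{P\}$ inductively by: $\{U\}\,x:=e\,\{U[x\mapsto e]\}$; $\{U\}\,\mathsf{skip}\,\{\langle U\rangle\}$; from $\{U\}\,s_0\,\{P\ast\ast\langle V\rangle\}$ and $\{V\}\,s_1\,\{Q\}$ infer $\{U\}\,s_0;s_1\,\{P\ast\ast Q\}$; from $\{e\wedge U\}\,s_t\,\{P\}$ and $\{\neg e\wedge U\}\,s_f\,\{P\}$ infer $\{U\}\,\mathsf{if}\ e\ \mathsf{then}\ s_t\ \mathsf{else}\ s_f\,\{\mathrm{dup}(U)\ast\ast P\}$; from $U\models I$ and $\{e\wedge I\}\,s_t\,\{P\ast\ast\langle I\rangle\}$ infer $\{U\}\,\mathsf{while}\ e\ \mathsf{do}\ s_t\,\{\mathrm{dup}(U)\ast\ast(P\ast\ast\mathrm{dup}(I))^{\dagger}\ast\ast\langle\neg e\rangle\}$; from $U\models U'$, $\{U'\}\,s\,\{P'\}$, $P'\models P$ infer $\{U\}\,s\,\{P\}$; from $\forall z.\ \{U_z\}\,s\,\{P_z\}$ infer $\{\exists z.U_z\}\,s\,\{\exists z.P_z\}$. -}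

module Defs where

open import Level using (Level; _⊔_; Lift; lift) renaming (suc to lsuc; zero to lzero)
open import Data.Nat using (ℕ; zero; suc; _≡ᵇ_)
open import Data.Integer using (ℤ; _+_; _-_; _*_; 0ℤ)
open import Data.Bool using (Bool; true; false) renaming (if_then_else_ to ifᵇ_then_else_)
open import Data.Product using (Σ; _×_; _,_; proj₁; proj₂)
open import Data.Sum using (_⊎_; inj₁; inj₂)
open import Data.Empty using (⊥-elim)
open import Relation.Nullary using (¬_)
open import Relation.Binary.PropositionalEquality using (_≡_; refl; sym; trans; cong; subst)

Var : Set
Var = ℕ

-- Arithmetic expressions (a concrete choice; nothing depends on it).
data Expr : Set where
  num  : ℤ → Expr
  var  : Var → Expr
  _⊕_  : Expr → Expr → Expr
  _⊖_  : Expr → Expr → Expr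
  _⊛_  : Expr → Expr → Expr

-- ('do' is an Agda keyword, hence 'do′')
data Stmt : Set where
  _≔_           : Var → Expr → Stmt
  skip          : Stmt
  _⨾_           : Stmt → Stmt → Stmt
  if_then_else_ : Expr → Stmt → Stmt → Stmt
  while_do′_    : Expr → Stmt → Stmt

State : Set
State = Var → ℤ

⟦_⟧ : Expr → State → ℤ
⟦ num n ⟧ σ = n
⟦ var x ⟧ σ = σ x
⟦ e ⊕ e' ⟧ σ = ⟦ e ⟧ σ + ⟦ e' ⟧ σ
⟦ e ⊖ e' ⟧ σ = ⟦ e ⟧ σ - ⟦ e' ⟧ σ
⟦ e ⊛ e' ⟧ σ = ⟦ e ⟧ σ * ⟦ e' ⟧ σ

-- σ ⊨ e : e is true in σ (convention: a nonzero value counts as true)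
_⊨ₑ_ : State → Expr → Set
σ ⊨ₑ e = ¬ (⟦ e ⟧ σ ≡ 0ℤ)

_[_↦_] : State → Var → ℤ → State
(σ [ x ↦ v ]) y = ifᵇ x ≡ᵇ y then v else σ y

-- Traces (possibly infinite, nonempty sequences of states).
-- All structure of traces is accessed through the shapes below:
--   IsEnd τ σ       :  τ is  ⟨ σ ⟩
--   IsCons τ σ      :  τ is  σ :: tl τ

Trace : Set
Trace = ℕ → State × Bool

hd : Trace → State
hd τ = proj₁ (τ zero)

tl : Trace → Trace
tl τ n = τ (suc n)

IsEnd : Trace → State → Set
IsEnd τ σ = τ zero ≡ (σ , true)

IsCons : Trace → State → Set
IsCons τ σ = τ zero ≡ (σ , false)

⟨_⟩ : State → Trace
⟨ σ ⟩ n = σ , true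

_∷_ : State → Trace → Trace
(σ ∷ τ) zero = σ , false
(σ ∷ τ) (suc n) = τ n

-- Coinductive definitions are encoded as greatest fixed points:
-- "x is in νF" iff "x lies in some post-fixed point R ⊆ F R".

BisimStep : (Trace → Trace → Set) → Trace → Trace → Set
BisimStep R τ τ' =
  (Σ State λ σ → IsEnd τ σ × IsEnd τ' σ) ⊎
  (Σ State λ σ → IsCons τ σ × IsCons τ' σ × R (tl τ) (tl τ'))

IsBisimulation : (Trace → Trace → Set) → Set
IsBisimulation R = ∀ τ τ' → R τ τ' → BisimStep R τ τ'

infix 4 _≈_
_≈_ : Trace → Trace → Set₁
τ ≈ τ' = Σ (Trace → Trace → Set) λ R → IsBisimulation R × R τ τ'

record EvalRel : Set₁ where
  field
    run : Stmt → State → Trace → Set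
    ext : Stmt → Trace → Trace → Set
open EvalRel public

data EvalStep (R : EvalRel) : Stmt → State → Trace → Set where
  ev-assign : ∀ {x e σ τ} →
    IsCons τ σ → IsEnd (tl τ) (σ [ x ↦ ⟦ e ⟧ σ ]) →
    EvalStep R (x ≔ e) σ τ
  ev-skip : ∀ {σ τ} → IsEnd τ σ → EvalStep R skip σ τ
  ev-seq : ∀ {s₀ s₁ σ τ τ'} →
    run R s₀ σ τ → ext R s₁ τ τ' → EvalStep R (s₀ ⨾ s₁) σ τ'
  ev-if-true : ∀ {e sₜ s_f σ τ} → σ ⊨ₑ e →
    ext R sₜ (σ ∷ ⟨ σ ⟩) τ → EvalStep R (if e then sₜ else s_f) σ τ
  ev-if-false : ∀ {e sₜ s_f σ τ} → ¬ (σ ⊨ₑ e) →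
    ext R s_f (σ ∷ ⟨ σ ⟩) τ → EvalStep R (if e then sₜ else s_f) σ τ
  ev-while-true : ∀ {e sₜ σ τ τ'} → σ ⊨ₑ e →
    ext R sₜ (σ ∷ ⟨ σ ⟩) τ → ext R (while e do′ sₜ) τ τ' →
    EvalStep R (while e do′ sₜ) σ τ'
  ev-while-false : ∀ {e sₜ σ τ} → ¬ (σ ⊨ₑ e) →
    IsCons τ σ → IsEnd (tl τ) σ →
    EvalStep R (while e do′ sₜ) σ τ

data ExtStep (R : EvalRel) : Stmt → Trace → Trace → Set where
  ext-end : ∀ {s τ σ τ'} → IsEnd τ σ → run R s σ τ' → ExtStep R s τ τ'
  ext-cons : ∀ {s τ σ τ'} → IsCons τ σ → IsCons τ' σ →
    ext R s (tl τ) (tl τ') → ExtStep R s τ τ'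

IsEvalRel : EvalRel → Set
IsEvalRel R =
  (∀ s σ τ → run R s σ τ → EvalStep R s σ τ) ×
  (∀ s τ τ' → ext R s τ τ' → ExtStep R s τ τ')

infix 3 _,_⇒_ _,_⇒*_
_,_⇒_ : Stmt → State → Trace → Set₁
s , σ ⇒ τ = Σ EvalRel λ R → IsEvalRel R × run R s σ τ

_,_⇒*_ : Stmt → Trace → Trace → Set₁
s , τ ⇒* τ' = Σ EvalRel λ R → IsEvalRel R × ext R s τ τ'

private
  ×-inj₁ : ∀ {a b : State} {c d : Bool} → (a , c) ≡ (b , d) → a ≡ b
  ×-inj₁ refl = refl

  true≢false : ∀ {a b : State} → (a , true) ≡ (b , false) → ∀ {ℓ} {A : Set ℓ} → A
  true≢false ()

≈-end : ∀ {τ τ' σ} → τ ≈ τ' → IsEnd τ σ → IsEnd τ' σ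
≈-end (R , post , r) e with post _ _ r
... | inj₁ (σ' , e₁ , e₂) = trans e₂ (cong (λ z → (z , true)) (×-inj₁ (trans (sym e₁) e)))
... | inj₂ (σ' , c₁ , c₂ , _) = true≢false (trans (sym e) c₁)

≈-cons : ∀ {τ τ' σ} → τ ≈ τ' → IsCons τ σ → IsCons τ' σ × tl τ ≈ tl τ'
≈-cons (R , post , r) c with post _ _ r
... | inj₁ (σ' , e₁ , e₂) = true≢false (trans (sym e₁) c)
... | inj₂ (σ' , c₁ , c₂ , r') =
  trans c₂ (cong (λ z → (z , false)) (×-inj₁ (trans (sym c₁) c))) , (R , post , r')

≈-hd : ∀ {τ τ'} → τ ≈ τ' → hd τ ≡ hd τ'
≈-hd (R , post , r) with post _ _ r
... | inj₁ (σ' , e₁ , e₂) = trans (cong proj₁ e₁) (sym (cong proj₁ e₂))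
... | inj₂ (σ' , c₁ , c₂ , _) = trans (cong proj₁ c₁) (sym (cong proj₁ c₂))

SPred : Set₁
SPred = State → Set

record TPred : Set₂ where
  field
    pred : Trace → Set₁
    resp : ∀ {τ τ'} → τ ≈ τ' → pred τ → pred τ'
open TPred public

_⊨_ : Trace → TPred → Set₁
τ ⊨ P = pred P τ

_⊨ˢ_ : SPred → SPred → Set
U ⊨ˢ V = ∀ σ → U σ → V σ

_⊨ᵗ_ : TPred → TPred → Set₁
P ⊨ᵗ Q = ∀ τ → τ ⊨ P → τ ⊨ Q

_∧ˢ_ : SPred → SPred → SPred
(U ∧ˢ V) σ = U σ × V σ

¬ˢ_ : SPred → SPred
(¬ˢ U) σ = ¬ U σ

∃ˢ : {Z : Set} → (Z → SPred) → SPred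
∃ˢ {Z} U σ = Σ Z λ z → U z σ

⌜_⌝ : Expr → SPred
⌜ e ⌝ σ = σ ⊨ₑ e

∃ᵗ : {Z : Set} → (Z → TPred) → TPred
∃ᵗ {Z} P = record
  { pred = λ τ → Σ Z λ z → τ ⊨ P z
  ; resp = λ { b (z , p) → z , resp (P z) b p } }

⟪_⟫ : SPred → TPred
⟪ U ⟫ = record
  { pred = λ τ → Lift _ (Σ State λ σ → IsEnd τ σ × U σ)
  ; resp = λ { b (lift (σ , e , u)) → lift (σ , ≈-end b e , u) } }

dupᵗ : SPred → TPred
dupᵗ U = record
  { pred = λ τ → Lift _ (Σ State λ σ → IsCons τ σ × IsEnd (tl τ) σ × U σ)
  ; resp = λ { b (lift (σ , c , e , u)) →
      lift (σ , proj₁ (≈-cons b c) , ≈-end (proj₂ (≈-cons b c)) e , u) } }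

_[_≔ᵗ_] : SPred → Var → Expr → TPred
U [ x ≔ᵗ e ] = record
  { pred = λ τ → Lift _ (Σ State λ σ →
                   IsCons τ σ × IsEnd (tl τ) (σ [ x ↦ ⟦ e ⟧ σ ]) × U σ)
  ; resp = λ { b (lift (σ , c , e' , u)) →
      lift (σ , proj₁ (≈-cons b c) , ≈-end (proj₂ (≈-cons b c)) e' , u) } }

FollowsStep : ∀ {ℓ : Level} → (Trace → Set ℓ) → (Trace → Trace → Set) →
              Trace → Trace → Set ℓ
FollowsStep {ℓ} Q R τ τ' =
  (Σ State λ σ → IsEnd τ σ × hd τ' ≡ σ × Q τ') ⊎
  (Lift ℓ (Σ State λ σ → IsCons τ σ × IsCons τ' σ × R (tl τ) (tl τ')))

Follows : ∀ {ℓ} → (Trace → Set ℓ) → Trace → Trace → Set (lsuc lzero ⊔ ℓ)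
Follows Q τ τ' =
  Σ (Trace → Trace → Set) λ R →
    (∀ a b → R a b → FollowsStep Q R a b) × R τ τ'

follows-map : ∀ {ℓ ℓ'} {Q : Trace → Set ℓ} {Q' : Trace → Set ℓ'}
  (B : Trace → Trace → Set) → IsBisimulation B →
  (∀ {c d} → B c d → Q c → Q' d) →
  ∀ {τ τ' τ''} → B τ' τ'' → Follows Q τ τ' → Follows Q' τ τ''
follows-map {Q = Q} {Q'} B postB f {τ} {τ'} {τ''} bb (R , post , r) =
  R' , post' , (τ' , r , bb)
  where
  R' : Trace → Trace → Set
  R' a d = Σ Trace λ c → R a c × B c d
  post' : ∀ a d → R' a d → FollowsStep Q' R' a d
  post' a d (c , rc , bcd) with post a c rc
  ... | inj₁ (σ , e , h , q) =
        inj₁ (σ , e , trans (sym (≈-hd (B , postB , bcd))) h , f bcd q)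
  ... | inj₂ (lift (σ , ca , cc , r')) with ≈-cons (B , postB , bcd) cc
  ...   | cd , _ with postB c d bcd
  ...     | inj₁ (σ' , e₁ , _) = true≢false (trans (sym e₁) cc)
  ...     | inj₂ (σ' , _ , _ , b') = inj₂ (lift (σ , ca , cd , (tl c , r' , b')))

infixr 5 _**_
_**_ : TPred → TPred → TPred
P ** Q = record
  { pred = λ τ' → Σ Trace λ τ → τ ⊨ P × Follows (pred Q) τ τ'
  ; resp = λ { (B , postB , bb) (τ , p , f) →
      τ , p , follows-map B postB (λ b q → resp Q (B , postB , b) q) bb f } }

DaggerStep : (Trace → Set₁) → (Trace → Set) → Trace → Set₁
DaggerStep P X τ' =
  Lift (lsuc lzero) (Σ State λ σ → IsEnd τ' σ) ⊎
  (Σ Trace λ τ → P τ × Follows X τ τ')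

Dagger : (Trace → Set₁) → Trace → Set₁
Dagger P τ' =
  Σ (Trace → Set) λ X → (∀ τ → X τ → DaggerStep P X τ) × X τ'

_† : TPred → TPred
P † = record { pred = Dagger (pred P) ; resp = r }
  where
  r : ∀ {τ τ'} → τ ≈ τ' → Dagger (pred P) τ → Dagger (pred P) τ'
  r {τ} {τ'} (B , postB , bb) (X , post , x) = X' , post' , (τ , x , bb)
    where
    X' : Trace → Set
    X' d = Σ Trace λ c → X c × B c d
    post' : ∀ d → X' d → DaggerStep (pred P) X' d
    post' d (c , xc , bcd) with post c xc
    ... | inj₁ (lift (σ , e)) = inj₁ (lift (σ , ≈-end (B , postB , bcd) e))
    ... | inj₂ (t , p , f) =
          inj₂ (t , p , follows-map B postB (λ {c'} b x' → c' , x' , b) bcd f)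

data ⊢[_]_[_] : SPred → Stmt → TPred → Set₂ where
  h-assign : ∀ {U x e} → ⊢[ U ] (x ≔ e) [ U [ x ≔ᵗ e ] ]
  h-skip : ∀ {U} → ⊢[ U ] skip [ ⟪ U ⟫ ]
  h-seq : ∀ {U V s₀ s₁ P Q} →
    ⊢[ U ] s₀ [ P ** ⟪ V ⟫ ] → ⊢[ V ] s₁ [ Q ] →
    ⊢[ U ] (s₀ ⨾ s₁) [ P ** Q ]
  h-if : ∀ {U e sₜ s_f P} →
    ⊢[ ⌜ e ⌝ ∧ˢ U ] sₜ [ P ] → ⊢[ (¬ˢ ⌜ e ⌝) ∧ˢ U ] s_f [ P ] →
    ⊢[ U ] (if e then sₜ else s_f) [ dupᵗ U ** P ]
  h-while : ∀ {U I e sₜ P} →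
    U ⊨ˢ I → ⊢[ ⌜ e ⌝ ∧ˢ I ] sₜ [ P ** ⟪ I ⟫ ] →
    ⊢[ U ] (while e do′ sₜ) [ dupᵗ U ** ((P ** dupᵗ I) †) ** ⟪ ¬ˢ ⌜ e ⌝ ⟫ ]
  h-conseq : ∀ {U U' s P P'} →
    U ⊨ˢ U' → ⊢[ U' ] s [ P' ] → P' ⊨ᵗ P → ⊢[ U ] s [ P ]
  h-ex : ∀ {Z : Set} {U : Z → SPred} {s} {P : Z → TPred} →
    (∀ z → ⊢[ U z ] s [ P z ]) → ⊢[ ∃ˢ U ] s [ ∃ᵗ P ]

module Submission where

-- Evaluation s , σ ⇒ τ is a greatest fixed point: it holds when run R s σ τ
-- for some evaluation relation R that unfolds into evaluation steps.  We fix
-- such an R and prove, by induction on the derivation of ⊢[ U ] s [ P ], that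
-- every R-run of s from a U-state satisfies P.
--
-- The loop
-- rule is handled by analysing the tail of a run of  while e do′ body : its
-- tails from invariant states form a post-fixed point of the  (P ** dup I) †
-- unfolding, and every tail ends in a state falsifying e.

open import Level using (lift)
open import Data.Nat using (zero; suc)
open import Data.Bool using (Bool; true; false)
open import Data.Product using (Σ; _×_; _,_; proj₁; proj₂)
open import Data.Sum using (_⊎_; inj₁; inj₂)
open import Data.Empty using (⊥; ⊥-elim)
open import Relation.Nullary using (¬_)
open import Relation.Binary.PropositionalEquality
  using (_≡_; _≗_; refl; sym; trans; cong; subst)
open import Defs

end≢cons : ∀ τ {σ σ'} → IsEnd τ σ → IsCons τ σ' → ⊥
end≢cons τ e c with trans (sym e) c
... | ()

end-injective : ∀ τ {σ σ'} → IsEnd τ σ → IsEnd τ σ' → σ ≡ σ'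
end-injective τ e e' = cong proj₁ (trans (sym e) e')

cons-injective : ∀ τ {σ σ'} → IsCons τ σ → IsCons τ σ' → σ ≡ σ'
cons-injective τ c c' = cong proj₁ (trans (sym c) c')

end-hd : ∀ τ {σ} → IsEnd τ σ → hd τ ≡ σ
end-hd τ = cong proj₁

cons-hd : ∀ τ {σ} → IsCons τ σ → hd τ ≡ σ
cons-hd τ = cong proj₁

follows-end : ∀ {ℓ} {Q : Trace → Set ℓ} {σ τ} → hd τ ≡ σ → Q τ → Follows Q ⟨ σ ⟩ τ
follows-end {Q = Q} {σ} {τ} h q = F , step , (refl , refl)
  where
  F : Trace → Trace → Set
  F a b = a ≡ ⟨ σ ⟩ × b ≡ τ
  step : ∀ a b → F a b → FollowsStep Q F a b
  step _ _ (refl , refl) = inj₁ (σ , refl , h , q)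

follows-cons : ∀ {ℓ} {Q : Trace → Set ℓ} {σ τ τ'} →
  IsCons τ' σ → Follows Q τ (tl τ') → Follows Q (σ ∷ τ) τ'
follows-cons {Q = Q} {σ} {τ} {τ'} c (F , step , f) = F' , step' , inj₂ (refl , refl)
  where
  F' : Trace → Trace → Set
  F' a b = F a b ⊎ (a ≡ σ ∷ τ × b ≡ τ')
  step' : ∀ a b → F' a b → FollowsStep Q F' a b
  step' _ _ (inj₂ (refl , refl)) = inj₂ (lift (σ , refl , c , inj₁ f))
  step' a b (inj₁ fab) with step a b fab
  ... | inj₁ ended = inj₁ ended
  ... | inj₂ (lift (σ' , ca , cb , f')) = inj₂ (lift (σ' , ca , cb , inj₁ f'))

-- dupLast τ is τ with its final state repeated: the final ⟨ σ ⟩ becomes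
-- σ :: ⟨ σ ⟩ (infinite traces are unchanged).  It turns a witness of P ** ⟨I⟩
-- into one of P ** dup(I), as needed for the body of a loop.
mutual
  dupLast : Trace → Trace
  dupLast τ zero = hd τ , false
  dupLast τ (suc n) = dupLast-after (τ zero) (tl τ) n

  dupLast-after : State × Bool → Trace → Trace
  dupLast-after (σ , true) τ n = σ , true
  dupLast-after (σ , false) τ n = dupLast τ n

dupLast-end : ∀ {τ τ' σ} → τ' ≗ dupLast τ → IsEnd τ σ → IsCons τ' σ × IsEnd (tl τ') σ
dupLast-end {τ} p e =
  trans (p 0) (cong (λ z → proj₁ z , false) e) ,
  trans (p 1) (cong (λ z → dupLast-after z (tl τ) 0) e)

dupLast-cons : ∀ {τ τ' σ} → τ' ≗ dupLast τ → IsCons τ σ → IsCons τ' σ × tl τ' ≗ dupLast (tl τ)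
dupLast-cons {τ} p c =
  trans (p 0) (cong (λ z → proj₁ z , false) c) ,
  λ n → trans (p (suc n)) (cong (λ z → dupLast-after z (tl τ) n) c)

follows-dupLast : ∀ {V : SPred} {τ τ'} →
  Follows (pred ⟪ V ⟫) τ τ' → Follows (pred (dupᵗ V)) τ (dupLast τ)
follows-dupLast {V} (F , step , f) = S , step' , ((λ _ → refl) , _ , f)
  where
  S : Trace → Trace → Set
  S a b = b ≗ dupLast a × Σ Trace (F a)
  step' : ∀ a b → S a b → FollowsStep (pred (dupᵗ V)) S a b
  step' a b (p , c , fac) with step a c fac
  ... | inj₁ (σ , ea , h , lift (σ' , ec , v)) with dupLast-end p ea
  ...   | cb , eb = inj₁ (σ , ea , cons-hd b cb ,
                      lift (σ , cb , eb , subst V (trans (sym (end-hd c ec)) h) v))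
  step' a b (p , c , fac) | inj₂ (lift (σ , ca , cc , f')) with dupLast-cons p ca
  ...   | cb , p' = inj₂ (lift (σ , ca , cb , (p' , tl c , f')))

-- If every Q-trace has the form σ :: τ with τ starting in σ and satisfying K,
-- then follows_Q (τ , τ') gives follows_K (dupLast τ , τ'): the repeated
-- final state of τ absorbs the leading state of the Q-part.
follows-dupLast-shift : ∀ {ℓ} {Q : Trace → Set ℓ} {K : Trace → Set} →
  (∀ b → Q b → Σ State λ σ → IsCons b σ × hd (tl b) ≡ σ × K (tl b)) →
  ∀ {τ τ'} → Follows Q τ τ' → Follows K (dupLast τ) τ'
follows-dupLast-shift {Q = Q} {K} split {τ} (F , step , f) =
  T , step' , inj₁ (τ , (λ _ → refl) , f)
  where
  T : Trace → Trace → Set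
  T a b = (Σ Trace λ a₀ → a ≗ dupLast a₀ × F a₀ b)
        ⊎ (Σ State λ σ → IsEnd a σ × hd b ≡ σ × K b)
  step' : ∀ a b → T a b → FollowsStep K T a b
  step' a b (inj₂ ended) = inj₁ ended
  step' a b (inj₁ (a₀ , p , fab)) with step a₀ b fab
  ... | inj₁ (σ , ea₀ , h , q) with split b q | dupLast-end p ea₀
  ...   | σ' , cb , h' , k | ca , ea =
          let σ'≡σ = trans (sym (cons-hd b cb)) h in
          inj₂ (lift (σ , ca , subst (IsCons b) σ'≡σ cb , inj₂ (σ , ea , trans h' σ'≡σ , k)))
  step' a b (inj₁ (a₀ , p , fab)) | inj₂ (lift (σ , ca₀ , cb , f')) with dupLast-cons p ca₀
  ...   | ca , p' = inj₂ (lift (σ , ca , cb , inj₁ (tl a₀ , p' , f')))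

module Evaluation (R : EvalRel) (isEval : IsEvalRel R) where

  private
    unfold-run : ∀ s σ τ → run R s σ τ → EvalStep R s σ τ
    unfold-run = proj₁ isEval

    unfold-ext : ∀ s τ τ' → ext R s τ τ' → ExtStep R s τ τ'
    unfold-ext = proj₂ isEval

  ext-cons-inv : ∀ {s τ τ' σ} → ext R s τ τ' → IsCons τ σ → IsCons τ' σ × ext R s (tl τ) (tl τ')
  ext-cons-inv {s} {τ} {τ'} x c with unfold-ext s τ τ' x
  ... | ext-end e _ = ⊥-elim (end≢cons τ e c)
  ... | ext-cons c₁ c₂ x' = subst (IsCons τ') (cons-injective τ c₁ c) c₂ , x'

  ext-end-inv : ∀ {s τ τ' σ} → ext R s τ τ' → IsEnd τ σ → run R s σ τ'
  ext-end-inv {s} {τ} {τ'} x e with unfold-ext s τ τ' x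
  ... | ext-end e' r = subst (λ σ → run R s σ τ') (end-injective τ e' e) r
  ... | ext-cons c _ _ = ⊥-elim (end≢cons τ e c)

  ext-dup-inv : ∀ {s σ τ} → ext R s (σ ∷ ⟨ σ ⟩) τ → IsCons τ σ × run R s σ (tl τ)
  ext-dup-inv x with ext-cons-inv x refl
  ... | c , x' = c , ext-end-inv x' refl

  mutual
    hd-run : ∀ s {σ τ} → run R s σ τ → hd τ ≡ σ
    hd-run s {σ} {τ} r with unfold-run s σ τ r
    ... | ev-assign c _ = cons-hd τ c
    ... | ev-skip e = end-hd τ e
    ... | ev-seq {s₁ = s₁} r₀ x₁ = trans (hd-ext s₁ x₁) (hd-run _ r₀)
    ... | ev-if-true _ x = cons-hd τ (proj₁ (ext-dup-inv x))
    ... | ev-if-false _ x = cons-hd τ (proj₁ (ext-dup-inv x))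
    ... | ev-while-true _ x xw = cons-hd τ (proj₁ (ext-cons-inv xw (proj₁ (ext-dup-inv x))))
    ... | ev-while-false _ c _ = cons-hd τ c

    hd-ext : ∀ s {τ τ'} → ext R s τ τ' → hd τ' ≡ hd τ
    hd-ext s {τ} {τ'} x with unfold-ext s τ τ' x
    ... | ext-end e r = trans (hd-run s r) (sym (end-hd τ e))
    ... | ext-cons c₁ c₂ _ = trans (cons-hd τ' c₂) (sym (cons-hd τ c₁))

  follows-ext : ∀ {ℓ} {V : SPred} {s} {Q : Trace → Set ℓ} →
    (∀ σ τ → V σ → run R s σ τ → Q τ) →
    ∀ {τ₀ τ τ'} → Follows (pred ⟪ V ⟫) τ₀ τ → ext R s τ τ' → Follows Q τ₀ τ'
  follows-ext {V = V} {s} {Q} runs (F , step , f) x = F' , step' , (_ , f , x)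
    where
    F' : Trace → Trace → Set
    F' a b = Σ Trace λ c → F a c × ext R s c b
    step' : ∀ a b → F' a b → FollowsStep Q F' a b
    step' a b (c , fac , x) with step a c fac
    ... | inj₁ (σ , ea , h , lift (σ' , ec , v)) =
          let r = ext-end-inv x ec in
          inj₁ (σ , ea , trans (hd-run s r) (trans (sym (end-hd c ec)) h) , runs σ' b v r)
    ... | inj₂ (lift (σ , ca , cc , f')) with ext-cons-inv x cc
    ...   | cb , x' = inj₂ (lift (σ , ca , cb , (tl c , f' , x')))

  module Loop (e : Expr) (body : Stmt) where

    W : Stmt
    W = while e do′ body

    -- LoopTail σ t : t is what follows the leading σ in a run of W from σ.
    LoopTail : State → Trace → Set
    LoopTail σ t = (¬ (σ ⊨ₑ e) × IsEnd t σ)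
                 ⊎ (σ ⊨ₑ e × Σ Trace λ τ → run R body σ τ × ext R W τ t)

    while-unfold : ∀ {σ τ} → run R W σ τ → IsCons τ σ × LoopTail σ (tl τ)
    while-unfold {σ} {τ} r with unfold-run W σ τ r
    ... | ev-while-false ne c en = c , inj₁ (ne , en)
    ... | ev-while-true ee x xw with ext-dup-inv x
    ...   | c , r₁ with ext-cons-inv xw c
    ...     | cτ , xw' = cτ , inj₂ (ee , _ , r₁ , xw')

    loopTail-hd : ∀ {σ t} → LoopTail σ t → hd t ≡ σ
    loopTail-hd {t = t} (inj₁ (_ , en)) = end-hd t en
    loopTail-hd (inj₂ (_ , _ , r , x)) = trans (hd-ext W x) (hd-run body r)

    -- ExitTail t : t is a suffix of a run of W (possibly just its final state).
    ExitTail : Trace → Set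
    ExitTail t = (Σ Trace λ τ → ext R W τ t) ⊎ (Σ State λ σ → IsEnd t σ × ¬ (σ ⊨ₑ e))

    loopTail-exitTail : ∀ {σ t} → LoopTail σ t → ExitTail t
    loopTail-exitTail (inj₁ (ne , en)) = inj₂ (_ , en , ne)
    loopTail-exitTail (inj₂ (_ , _ , _ , x)) = inj₁ (_ , x)

    exitTail-step : ∀ {t} → ExitTail t →
      (Σ State λ σ → IsEnd t σ × ¬ (σ ⊨ₑ e)) ⊎ (Σ State λ σ → IsCons t σ × ExitTail (tl t))
    exitTail-step (inj₂ ended) = inj₁ ended
    exitTail-step {t} (inj₁ (τ , x)) with unfold-ext W τ t x
    ... | ext-cons {σ = σ} _ c x' = inj₂ (σ , c , inj₁ (_ , x'))
    ... | ext-end {σ = σ} _ r with while-unfold r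
    ...   | c , lt = inj₂ (σ , c , loopTail-exitTail lt)

    exit-follows : ∀ {t} → ExitTail t → Follows (pred ⟪ ¬ˢ ⌜ e ⌝ ⟫) t t
    exit-follows x = F , step , (refl , x)
      where
      F : Trace → Trace → Set
      F a b = a ≡ b × ExitTail a
      step : ∀ a b → F a b → FollowsStep (pred ⟪ ¬ˢ ⌜ e ⌝ ⟫) F a b
      step a .a (refl , x) with exitTail-step x
      ... | inj₁ (σ , en , ne) = inj₁ (σ , en , end-hd a en , lift (σ , en , ne))
      ... | inj₂ (σ , c , x') = inj₂ (lift (σ , c , c , refl , x'))

    module Invariant (I : SPred) (P : TPred)
      (body-sound : ∀ σ τ → (⌜ e ⌝ ∧ˢ I) σ → run R body σ τ → τ ⊨ (P ** ⟪ I ⟫)) where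

      InvTail : Trace → Set
      InvTail t = Σ State λ σ → I σ × LoopTail σ t

      run-stutters : ∀ τ → (Σ State λ σ → I σ × run R W σ τ) →
        Σ State λ σ → IsCons τ σ × hd (tl τ) ≡ σ × InvTail (tl τ)
      run-stutters τ (σ , i , r) with while-unfold r
      ... | c , lt = σ , c , loopTail-hd lt , (σ , i , lt)

      iteration : ∀ t → InvTail t → DaggerStep (pred (P ** dupᵗ I)) InvTail t
      iteration t (σ , i , inj₁ (ne , en)) = inj₁ (lift (σ , en))
      iteration t (σ , i , inj₂ (ee , τ , r , x)) with body-sound σ τ (ee , i) r
      ... | τ₀ , p , f =
        inj₂ (dupLast τ₀ , (τ₀ , p , follows-dupLast f) ,
              follows-dupLast-shift run-stutters (follows-ext (λ σ' τ' i' r' → σ' , i' , r') f x))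

      while-sound : ∀ {U : SPred} → U ⊨ˢ I → ∀ σ τ → U σ → run R W σ τ →
        τ ⊨ (dupᵗ U ** ((P ** dupᵗ I) †) ** ⟪ ¬ˢ ⌜ e ⌝ ⟫)
      while-sound U⊨I σ τ u r with while-unfold r
      ... | c , lt =
        σ ∷ ⟨ σ ⟩ , lift (σ , refl , refl , u) ,
        follows-cons c (follows-end (loopTail-hd lt)
          (tl τ , (InvTail , iteration , (σ , U⊨I σ u , lt)) ,
           exit-follows (loopTail-exitTail lt)))

  sound : ∀ {U s P} → ⊢[ U ] s [ P ] → ∀ σ τ → U σ → run R s σ τ → τ ⊨ P
  sound h-assign σ τ u r with unfold-run _ σ τ r
  ... | ev-assign c e = lift (σ , c , e , u)
  sound h-skip σ τ u r with unfold-run _ σ τ r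
  ... | ev-skip e = lift (σ , e , u)
  sound (h-seq d₀ d₁) σ τ u r with unfold-run _ σ τ r
  ... | ev-seq r₀ x₁ with sound d₀ σ _ u r₀
  ...   | τ₀ , p , f = τ₀ , p , follows-ext (sound d₁) f x₁
  sound (h-if dₜ d_f) σ τ u r with unfold-run _ σ τ r
  ... | ev-if-true ee x with ext-dup-inv x
  ...   | c , r₁ = σ ∷ ⟨ σ ⟩ , lift (σ , refl , refl , u) ,
                   follows-cons c (follows-end (hd-run _ r₁) (sound dₜ σ _ (ee , u) r₁))
  sound (h-if dₜ d_f) σ τ u r | ev-if-false ne x with ext-dup-inv x
  ...   | c , r₁ = σ ∷ ⟨ σ ⟩ , lift (σ , refl , refl , u) ,
                   follows-cons c (follows-end (hd-run _ r₁) (sound d_f σ _ (ne , u) r₁))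
  sound (h-while {I = I} {e = e} {sₜ = body} {P = P} U⊨I d) σ τ u r =
    Loop.Invariant.while-sound e body I P (sound d) U⊨I σ τ u r
  sound (h-conseq U⊨U' d P'⊨P) σ τ u r = P'⊨P τ (sound d σ τ (U⊨U' σ u) r)
  sound (h-ex ds) σ τ (z , u) r = z , sound (ds z) σ τ u r

proposition3p8 : (s : Stmt) (U : SPred) (P : TPred) →
    ⊢[ U ] s [ P ] →
    ∀ (σ : State) (τ : Trace) → U σ → s , σ ⇒ τ → τ ⊨ P
proposition3p8 s U P d σ τ u (R , isEval , r) = Evaluation.sound R isEval d σ τ u r
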